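{- Let $G$ be a finite, simple graph that contains an induced path $P: xuvwy$ of order $5$ whose internal vertices $u,v,w$ have degree $2$ in $G$. Let $G'$ be the graph obtained from $G$ by contracting three edges of $P$, that is, by deleting $u$, $v$, $w$ and adding the edge $xy$. Then $n(G')=n(G)-3$, $\gamma_{r2}(G)\leq \gamma_{r2}(G')+2$, and $\gamma_R(G)\leq \gamma_R(G')+2$.
   Context: A $2$-rainbow dominating function of a graph $G$ is a function $f:V(G)\to 2^{\{1,2\}}$ such that $\bigcup_{v\in N_G(u)}f(v)=\{1,2\}$ for every vertex $u$ with $f(u)=\emptyset$; its weight is $\sum_{u\in V(G)}|f(u)|$, and $\gamma_{r2}(G)$ is the minimum weight of such a function. A Roman dominating function of $G$ is a function $g:V(G)\to\{0,1,2\}$ such that every vertex $u$ with $g(u)=0$ has a neighbor $v$ with $g(v)=2$; its weight is $\sum_{u\in V(G)}g(u)$, and $\gamma_R(G)$ is the minimum weight of such a function. $n(G)$ denotes the number of vertices of $G$. -}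

module Defs where

open import Data.Bool using (Bool; true; false; T; not; _∨_; _∧_; if_then_else_)
open import Data.Bool.Properties using (T-irrelevant)
open import Data.Nat using (ℕ; zero; suc; _+_)
open import Data.Fin using (Fin; toℕ)
open import Data.List using (List; []; _∷_; length; map; filterᵇ)
open import Data.Nat.ListAction using (sum)
open import Data.List.Membership.Propositional using (_∈_)
open import Data.List.Relation.Unary.Any using (here; there)
open import Data.List.Relation.Unary.All using (All; []; _∷_)
open import Data.List.Relation.Unary.AllPairs using ([]; _∷_)
open import Data.List.Relation.Unary.Unique.Propositional using (Unique)
open import Data.Product using (Σ; _,_; proj₁; proj₂; _×_; ∃)
open import Relation.Binary.Definitions using (DecidableEquality)
open import Relation.Binary.PropositionalEquality using (_≡_; _≢_; refl; cong; sym; trans)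
open import Relation.Nullary using (yes; no; ¬_; does)
open import Relation.Nullary.Decidable using (T?)

record Graph : Set₁ where
  field
    V        : Set
    _≟_      : DecidableEquality V
    vertices : List V
    complete : ∀ a → a ∈ vertices
    unique   : Unique vertices
    adj      : V → V → Bool
    adj-sym  : ∀ a b → adj a b ≡ adj b a
    adj-irr  : ∀ a → adj a a ≡ false

open Graph public

order : Graph → ℕ
order G = length (vertices G)

neighbours : (G : Graph) → V G → List (V G)
neighbours G a = filterᵇ (adj G a) (vertices G)

degree : (G : Graph) → V G → ℕ
degree G a = length (neighbours G a)

Adj : (G : Graph) → V G → V G → Set
Adj G a b = T (adj G a b)

record InducedP5 (G : Graph) (x u v w y : V G) : Set where
  field
    x≢u : x ≢ u
    x≢v : x ≢ v
    x≢w : x ≢ w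
    x≢y : x ≢ y
    u≢v : u ≢ v
    u≢w : u ≢ w
    u≢y : u ≢ y
    v≢w : v ≢ w
    v≢y : v ≢ y
    w≢y : w ≢ y
    xu : Adj G x u
    uv : Adj G u v
    vw : Adj G v w
    wy : Adj G w y
    ¬xv : ¬ Adj G x v
    ¬xw : ¬ Adj G x w
    ¬xy : ¬ Adj G x y
    ¬uw : ¬ Adj G u w
    ¬uy : ¬ Adj G u y
    ¬vy : ¬ Adj G v y

-- 2-rainbow domination.  A subset of {1,2} is a pair of Booleans
-- (1 ∈ S , 2 ∈ S).

Sub12 : Set
Sub12 = Bool × Bool

size12 : Sub12 → ℕ
size12 (a , b) = (if a then 1 else 0) + (if b then 1 else 0)

isEmpty12 : Sub12 → Bool
isEmpty12 (a , b) = not (a ∨ b)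

Is2RDF : (G : Graph) → (V G → Sub12) → Set
Is2RDF G f = ∀ a → T (isEmpty12 (f a)) →
  (∃ λ b → Adj G a b × T (proj₁ (f b))) × (∃ λ b → Adj G a b × T (proj₂ (f b)))

weight2R : (G : Graph) → (V G → Sub12) → ℕ
weight2R G f = sum (map (λ a → size12 (f a)) (vertices G))

IsRainbowDomNumber : Graph → ℕ → Set
IsRainbowDomNumber G k =
  (Σ (V G → Sub12) λ f → Is2RDF G f × weight2R G f ≡ k) ×
  (∀ f → Is2RDF G f → k Data.Nat.≤ weight2R G f)

IsRDF : (G : Graph) → (V G → Fin 3) → Set
IsRDF G g = ∀ a → toℕ (g a) ≡ 0 → ∃ λ b → Adj G a b × toℕ (g b) ≡ 2

weightR : (G : Graph) → (V G → Fin 3) → ℕ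
weightR G g = sum (map (λ a → toℕ (g a)) (vertices G))

IsRomanDomNumber : Graph → ℕ → Set
IsRomanDomNumber G k =
  (Σ (V G → Fin 3) λ g → IsRDF G g × weightR G g ≡ k) ×
  (∀ g → IsRDF G g → k Data.Nat.≤ weightR G g)

module _ {A : Set} (p : A → Bool) where

  SubT : Set
  SubT = Σ A (λ z → T (p z))

  subList : List A → List SubT
  subList [] = []
  subList (z ∷ zs) with T? (p z)
  ... | yes t = (z , t) ∷ subList zs
  ... | no _  = subList zs

  subList-complete : ∀ (s : SubT) (l : List A) → proj₁ s ∈ l → s ∈ subList l
  subList-complete (z , t) (z' ∷ zs) (here refl) with T? (p z)
  ... | yes t' = here (cong (z ,_) (T-irrelevant t t'))
  ... | no ¬t  = Data.Empty.⊥-elim (¬t t)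
    where import Data.Empty
  subList-complete s (z' ∷ zs) (there i) with T? (p z')
  ... | yes _ = there (subList-complete s zs i)
  ... | no _  = subList-complete s zs i

  subList-all : ∀ (z : A) (t : T (p z)) (l : List A) →
    All (z ≢_) l → All ((z , t) ≢_) (subList l)
  subList-all z t [] [] = []
  subList-all z t (z' ∷ zs) (n ∷ ns) with T? (p z')
  ... | yes t' = (λ e → n (cong proj₁ e)) ∷ subList-all z t zs ns
  ... | no _   = subList-all z t zs ns

  subList-unique : ∀ l → Unique l → Unique (subList l)
  subList-unique [] [] = []
  subList-unique (z ∷ zs) (n ∷ u) with T? (p z)
  ... | yes t = subList-all z t zs n ∷ subList-unique zs u
  ... | no _  = subList-unique zs u

  subDecEq : DecidableEquality A → DecidableEquality SubT
  subDecEq eq (a , s) (b , t) with eq a b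
  ... | yes refl = yes (cong (a ,_) (T-irrelevant s t))
  ... | no ne    = no (λ e → ne (cong proj₁ e))

module Contract (G : Graph) (x u v w y : V G) (x≢y : x ≢ y) where
  private
    _≟G_ = _≟_ G
    is : V G → V G → Bool
    is a b = does (a ≟G b)

  keep : V G → Bool
  keep z = not (is z u ∨ is z v ∨ is z w)

  xyEdge : V G → V G → Bool
  xyEdge a b = (is a x ∧ is b y) ∨ (is a y ∧ is b x)

  adj' : SubT keep → SubT keep → Bool
  adj' (a , _) (b , _) = adj G a b ∨ xyEdge a b

  ∨-comm : ∀ p q → (p ∨ q) ≡ (q ∨ p)
  ∨-comm false false = refl
  ∨-comm false true = refl
  ∨-comm true false = refl
  ∨-comm true true = refl

  adj'-sym : ∀ s t → adj' s t ≡ adj' t s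
  adj'-sym (a , _) (b , _)
    rewrite adj-sym G a b
          | ∨-comm (is a x ∧ is b y) (is a y ∧ is b x)
          | Data.Bool.Properties.∧-comm (is a x) (is b y)
          | Data.Bool.Properties.∧-comm (is a y) (is b x) = refl
    where import Data.Bool.Properties

  xyEdge-irr : ∀ a → xyEdge a a ≡ false
  xyEdge-irr a with a ≟G x | a ≟G y
  ... | yes refl | yes refl = Data.Empty.⊥-elim (x≢y refl)
    where import Data.Empty
  ... | yes _ | no _ = refl
  ... | no _ | yes _ = refl
  ... | no _ | no _ = refl

  adj'-irr : ∀ s → adj' s s ≡ false
  adj'-irr (a , _) rewrite adj-irr G a | xyEdge-irr a = refl

  G' : Graph
  G' = record
    { V        = SubT keep
    ; _≟_      = subDecEq keep (_≟_ G)
    ; vertices = subList keep (vertices G)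
    ; complete = λ s → subList-complete keep s (vertices G) (complete G (proj₁ s))
    ; unique   = subList-unique keep (vertices G) (unique G)
    ; adj      = adj'
    ; adj-sym  = adj'-sym
    ; adj-irr  = adj'-irr
    }

module Submission where

-- 1. The vertices of G are those of G' together with u, v, w, so every vertex
--    sum over G is the sum over G' plus the values at u, v, w (vertexSum-split).
--    Summing the constant 1 gives the order of G'.
-- 2. Roman and 2-rainbow domination are both instances of "every vertex whose
--    label satisfies P has a neighbour whose label satisfies Q" (Dominates).
--    A labelling f' of G' is extended to G by a Patch of labels for u, v, w.
--    Since G and G' differ only around the path, the extension dominates G as
--    soon as five local conditions hold (Repair); they only involve the labels
--    X, Y of x and y (extend-dominates).
-- 3. For each of the finitely many pairs (X, Y) we exhibit a patch of weight 2
--    satisfying Repair; this is checked by evaluating decision procedures.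
-- 4. Extending a minimum function of G' thus yields a function of G of weight
--    γ(G') + 2, and minimality of γ(G) gives both bounds.

open import Defs
open import Data.Nat using (ℕ; _+_; _∸_; _≤_)
open import Relation.Binary.PropositionalEquality using (_≡_)
open import Data.Product using (_×_)

open import Data.Bool using (Bool; true; false; T; not; _∧_; if_then_else_)
open import Data.Bool.Properties using (T-irrelevant; T-≡; T-∨; T-∧)
open import Data.Empty using (⊥-elim)
open import Data.Fin using (Fin; toℕ; zero; suc; #_)
open import Data.List using (List; []; _∷_; length; map; allFin)
open import Data.List.Membership.Propositional using (_∈_)
open import Data.List.Membership.Propositional.Properties using (∈-allFin)
open import Data.List.Properties using (map-cong)
open import Data.List.Relation.Unary.All using (All; []; _∷_; all?)
import Data.List.Relation.Unary.All as All
open import Data.List.Relation.Unary.Any using (here; there)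
open import Data.List.Relation.Unary.AllPairs using (_∷_)
open import Data.List.Relation.Unary.Unique.Propositional using (Unique)
open import Data.Nat.ListAction using (sum)
open import Data.Nat.Properties
  using (+-identityʳ; m+n∸n≡m; ≤-reflexive; ≤-trans; +-commutativeSemigroup)
  renaming (_≟_ to _≟ℕ_)
open import Algebra.Properties.CommutativeSemigroup +-commutativeSemigroup using (interchange)
open import Data.Product using (∃; _,_; proj₁; proj₂)
open import Data.Sum using (_⊎_; inj₁; inj₂; [_,_])
open import Function using (_∘_; Equivalence)
open import Relation.Binary.Definitions using (DecidableEquality)
open import Relation.Binary.PropositionalEquality
  using (_≢_; refl; sym; trans; cong; cong₂; subst; module ≡-Reasoning)
open import Relation.Nullary using (¬_; Dec; yes; no; does)
open import Relation.Nullary.Decidable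
  using (True; toWitness; map′; T?; dec-true; dec-false; _→-dec_; _×-dec_; _⊎-dec_)
open import Relation.Unary using (Decidable)

open ≡-Reasoning

sum-map-+ : ∀ {A : Set} (f g : A → ℕ) (l : List A) →
  sum (map (λ z → f z + g z) l) ≡ sum (map f l) + sum (map g l)
sum-map-+ f g [] = refl
sum-map-+ f g (z ∷ l) = begin
  (f z + g z) + sum (map (λ z → f z + g z) l)  ≡⟨ cong (f z + g z +_) (sum-map-+ f g l) ⟩
  (f z + g z) + (sum (map f l) + sum (map g l)) ≡⟨ interchange (f z) (g z) _ _ ⟩
  (f z + sum (map f l)) + (g z + sum (map g l)) ∎

sum-ones : ∀ {A : Set} (l : List A) → sum (map (λ _ → 1) l) ≡ length l
sum-ones [] = refl
sum-ones (_ ∷ l) = cong (1 +_) (sum-ones l)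

restrict : ∀ {A : Set} → (A → Bool) → (A → ℕ) → A → ℕ
restrict p h z = if p z then h z else 0

sum-restrict : ∀ {A : Set} (p : A → Bool) (h : A → ℕ) (l : List A) →
  sum (map (restrict p h) l) ≡ sum (map (h ∘ proj₁) (subList p l))
sum-restrict p h [] = refl
sum-restrict p h (z ∷ l) with T? (p z)
... | yes pz rewrite Equivalence.to T-≡ pz = cong (h z +_) (sum-restrict p h l)
... | no ¬pz rewrite dec-false (T? (p z)) ¬pz = sum-restrict p h l

module PointMass {A : Set} (_≟_ : DecidableEquality A) where

  pointMass : A → ℕ → A → ℕ
  pointMass a c z = if does (z ≟ a) then c else 0

  sum-pointMass-absent : ∀ a c l → All (a ≢_) l → sum (map (pointMass a c) l) ≡ 0
  sum-pointMass-absent a c [] [] = refl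
  sum-pointMass-absent a c (z ∷ l) (a≢z ∷ a∉l)
    rewrite dec-false (z ≟ a) (a≢z ∘ sym) = sum-pointMass-absent a c l a∉l

  sum-pointMass : ∀ a c l → Unique l → a ∈ l → sum (map (pointMass a c) l) ≡ c
  sum-pointMass a c (z ∷ l) (a∉l ∷ _) (here refl)
    rewrite dec-true (a ≟ a) refl | sum-pointMass-absent a c l a∉l = +-identityʳ c
  sum-pointMass a c (z ∷ l) (z∉l ∷ l-unique) (there a∈l)
    rewrite dec-false (z ≟ a) (All.lookup z∉l a∈l) = sum-pointMass a c l l-unique a∈l

byExhaustion₂ : ∀ {A : Set} {R : A → A → Set} (R? : ∀ a b → Dec (R a b))
  (l : List A) → (∀ a → a ∈ l) → True (all? (λ a → all? (R? a) l) l) → ∀ a b → R a b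
byExhaustion₂ R? l complete ok a b =
  All.lookup (All.lookup (toWitness ok) (complete a)) (complete b)

-- Roman
-- domination is the case (label 0, label 2); 2-rainbow domination is the
-- conjunction of the cases (∅, contains 1) and (∅, contains 2).
Dominates : ∀ {A : Set} (P Q : A → Set) (H : Graph) → (V H → A) → Set
Dominates P Q H f = ∀ a → P (f a) → ∃ λ b → Adj H a b × Q (f b)

record Patch (A : Set) : Set where
  constructor ⟨_,_,_⟩
  field
    atU atV atW : A

open Patch

cost : ∀ {A : Set} → (A → ℕ) → Patch A → ℕ
cost h p = h (atU p) + (h (atV p) + h (atW p))

-- Besides the deleted vertices, x and
-- y are affected: in G they lose each other as neighbours.
record Repair {A : Set} (P Q : A → Set) (X Y : A) (p : Patch A) : Set where
  field
    at-u : P (atU p) → Q X ⊎ Q (atV p)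
    at-v : P (atV p) → Q (atU p) ⊎ Q (atW p)
    at-w : P (atW p) → Q (atV p) ⊎ Q Y
    at-x : P X → Q Y → Q (atU p)
    at-y : P Y → Q X → Q (atW p)

repair? : ∀ {A : Set} {P Q : A → Set} → Decidable P → Decidable Q →
  ∀ X Y p → Dec (Repair P Q X Y p)
repair? P? Q? X Y p = map′
  (λ (cu , cv , cw , cx , cy) → record
    { at-u = cu ; at-v = cv ; at-w = cw ; at-x = cx ; at-y = cy })
  (λ r → let open Repair r in at-u , at-v , at-w , at-x , at-y)
  ((P? (atU p) →-dec (Q? X ⊎-dec Q? (atV p))) ×-dec
   (P? (atV p) →-dec (Q? (atU p) ⊎-dec Q? (atW p))) ×-dec
   (P? (atW p) →-dec (Q? (atV p) ⊎-dec Q? Y)) ×-dec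
   (P? X →-dec (Q? Y →-dec Q? (atU p))) ×-dec
   (P? Y →-dec (Q? X →-dec Q? (atW p))))

module Reduction (G : Graph) {x u v w y : V G} (path : InducedP5 G x u v w y) where
  open InducedP5 path
  open Contract G x u v w y x≢y public

  Adj-sym : ∀ {a b} → Adj G a b → Adj G b a
  Adj-sym {a} {b} = subst T (adj-sym G a b)

  u-deleted : ¬ T (keep u)
  u-deleted rewrite dec-true (_≟_ G u u) refl = λ ()

  v-deleted : ¬ T (keep v)
  v-deleted rewrite dec-false (_≟_ G v u) (u≢v ∘ sym) | dec-true (_≟_ G v v) refl = λ ()

  w-deleted : ¬ T (keep w)
  w-deleted rewrite dec-false (_≟_ G w u) (u≢w ∘ sym) | dec-false (_≟_ G w v) (v≢w ∘ sym)
                  | dec-true (_≟_ G w w) refl = λ ()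

  survivor : ∀ z → z ≢ u → z ≢ v → z ≢ w → V G'
  survivor z z≢u z≢v z≢w = z , kept
    where
      kept : T (keep z)
      kept rewrite dec-false (_≟_ G z u) z≢u | dec-false (_≟_ G z v) z≢v
                 | dec-false (_≟_ G z w) z≢w = _

  x' y' : V G'
  x' = survivor x x≢u x≢v x≢w
  y' = survivor y (u≢y ∘ sym) (v≢y ∘ sym) (w≢y ∘ sym)

  lift-≡ : ∀ {s t : V G'} → proj₁ s ≡ proj₁ t → s ≡ t
  lift-≡ {a , ka} {a , ka'} refl = cong (a ,_) (T-irrelevant ka ka')

  _==_ : V G → V G → Bool
  a == b = does (_≟_ G a b)

  ==-sound : ∀ {a b} → T (a == b) → a ≡ b
  ==-sound {a} {b} t with _≟_ G a b
  ... | yes a≡b = a≡b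

  G'-edge : ∀ {s t} → Adj G' s t →
    Adj G (proj₁ s) (proj₁ t) ⊎ (s ≡ x' × t ≡ y') ⊎ (s ≡ y' × t ≡ x')
  G'-edge {a , _} {b , _} s~t with Equivalence.to (T-∨ {adj G a b}) s~t
  ... | inj₁ a~b = inj₁ a~b
  ... | inj₂ new with Equivalence.to (T-∨ {a == x ∧ b == y}) new
  ... | inj₁ xy = let (a≡x , b≡y) = Equivalence.to (T-∧ {a == x}) xy
                  in inj₂ (inj₁ (lift-≡ (==-sound a≡x) , lift-≡ (==-sound b≡y)))
  ... | inj₂ yx = let (a≡y , b≡x) = Equivalence.to (T-∧ {a == y}) yx
                  in inj₂ (inj₂ (lift-≡ (==-sound a≡y) , lift-≡ (==-sound b≡x)))

  data Position : V G → Set where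
    kept : (s : V G') → Position (proj₁ s)
    is-u : Position u
    is-v : Position v
    is-w : Position w

  position : ∀ z → Position z
  position z with T? (keep z)
  ... | yes kz = kept (z , kz)
  ... | no ¬kz with _≟_ G z u | _≟_ G z v | _≟_ G z w
  ...   | yes refl | _        | _        = is-u
  ...   | no _     | yes refl | _        = is-v
  ...   | no _     | no _     | yes refl = is-w
  ...   | no _     | no _     | no _     = ⊥-elim (¬kz _)

  open PointMass (_≟_ G)

  split-pointwise : (h : V G → ℕ) (z : V G) →
    h z ≡ restrict keep h z + (pointMass u (h u) z + (pointMass v (h v) z + pointMass w (h w) z))
  split-pointwise h z with _≟_ G z u | _≟_ G z v | _≟_ G z w
  ... | yes refl | yes u≡v | _        = ⊥-elim (u≢v u≡v)
  ... | yes refl | no _    | yes u≡w  = ⊥-elim (u≢w u≡w)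
  ... | yes refl | no _    | no _     = sym (+-identityʳ (h u))
  ... | no _     | yes refl | yes v≡w = ⊥-elim (v≢w v≡w)
  ... | no _     | yes refl | no _    = sym (+-identityʳ (h v))
  ... | no _     | no _    | yes refl = refl
  ... | no _     | no _    | no _     = sym (+-identityʳ (h z))

  vertexSum-split : (h : V G → ℕ) →
    sum (map h (vertices G)) ≡ sum (map (h ∘ proj₁) (vertices G')) + (h u + (h v + h w))
  vertexSum-split h = begin
    sum (map h VG)
      ≡⟨ cong sum (map-cong (split-pointwise h) VG) ⟩
    sum (map (λ z → restrict keep h z + (δu z + (δv z + δw z))) VG)
      ≡⟨ sum-map-+ (restrict keep h) _ VG ⟩
    sum (map (restrict keep h) VG) + sum (map (λ z → δu z + (δv z + δw z)) VG)
      ≡⟨ cong (sum (map (restrict keep h) VG) +_) (trans (sum-map-+ δu _ VG)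
           (cong (sum (map δu VG) +_) (sum-map-+ δv δw VG))) ⟩
    sum (map (restrict keep h) VG) + (sum (map δu VG) + (sum (map δv VG) + sum (map δw VG)))
      ≡⟨ cong₂ _+_ (sum-restrict keep h VG)
           (cong₂ _+_ (mass u) (cong₂ _+_ (mass v) (mass w))) ⟩
    sum (map (h ∘ proj₁) (vertices G')) + (h u + (h v + h w)) ∎
    where
      VG = vertices G
      δu = pointMass u (h u)
      δv = pointMass v (h v)
      δw = pointMass w (h w)
      mass : ∀ a → sum (map (pointMass a (h a)) VG) ≡ h a
      mass a = sum-pointMass a (h a) VG (unique G) (complete G a)

  -- n(G') = n(G) - 3: sum the constant 1 in vertexSum-split.
  order-G' : order G' ≡ order G ∸ 3
  order-G' = begin
    order G'          ≡⟨ sym (m+n∸n≡m (order G') 3) ⟩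
    order G' + 3 ∸ 3  ≡⟨ cong (_∸ 3) (sym order-G) ⟩
    order G ∸ 3       ∎
    where
      order-G : order G ≡ order G' + 3
      order-G = trans (sym (sum-ones (vertices G)))
        (trans (vertexSum-split (λ _ → 1)) (cong (_+ 3) (sum-ones (vertices G'))))

  module Extension {A : Set} (f' : V G' → A) (p : Patch A) where

    extend : V G → A
    extend z with T? (keep z)
    ... | yes kz = f' (z , kz)
    ... | no _   = if does (_≟_ G z u) then atU p else if does (_≟_ G z v) then atV p else atW p

    extend-kept : (s : V G') → extend (proj₁ s) ≡ f' s
    extend-kept (z , kz) with T? (keep z)
    ... | yes kz' = cong (λ k → f' (z , k)) (T-irrelevant kz' kz)
    ... | no ¬kz  = ⊥-elim (¬kz kz)

    extend-u : extend u ≡ atU p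
    extend-u with T? (keep u)
    ... | yes ku = ⊥-elim (u-deleted ku)
    ... | no _ rewrite dec-true (_≟_ G u u) refl = refl

    extend-v : extend v ≡ atV p
    extend-v with T? (keep v)
    ... | yes kv = ⊥-elim (v-deleted kv)
    ... | no _ rewrite dec-false (_≟_ G v u) (u≢v ∘ sym) | dec-true (_≟_ G v v) refl = refl

    extend-w : extend w ≡ atW p
    extend-w with T? (keep w)
    ... | yes kw = ⊥-elim (w-deleted kw)
    ... | no _ rewrite dec-false (_≟_ G w u) (u≢w ∘ sym) | dec-false (_≟_ G w v) (v≢w ∘ sym) = refl

    extend-weight : (h : A → ℕ) →
      sum (map (h ∘ extend) (vertices G)) ≡ sum (map (h ∘ f') (vertices G')) + cost h p
    extend-weight h = trans (vertexSum-split (h ∘ extend)) (cong₂ _+_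
      (cong sum (map-cong (cong h ∘ extend-kept) (vertices G')))
      (cong₂ _+_ (cong h extend-u) (cong₂ _+_ (cong h extend-v) (cong h extend-w))))

    module _ {P Q : A → Set} (f'-dominates : Dominates P Q G' f')
             (repair : Repair P Q (f' x') (f' y') p) where
      open Repair repair

      -- A surviving vertex keeps its dominating neighbour from G', except
      -- that u replaces y as neighbour of x, and w replaces x as neighbour of y.
      dominated-kept : ∀ s → P (f' s) → ∃ λ b → Adj G (proj₁ s) b × Q (extend b)
      dominated-kept s Ps with f'-dominates s Ps
      ... | t , s~t , Qt with G'-edge {s} {t} s~t
      ...   | inj₁ edge                  = proj₁ t , edge , subst Q (sym (extend-kept t)) Qt
      ...   | inj₂ (inj₁ (refl , refl)) = u , xu , subst Q (sym extend-u) (at-x Ps Qt)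
      ...   | inj₂ (inj₂ (refl , refl)) = w , Adj-sym wy , subst Q (sym extend-w) (at-y Ps Qt)

      extend-dominates : Dominates P Q G extend
      extend-dominates a Pa with position a
      ... | kept s = dominated-kept s (subst P (extend-kept s) Pa)
      ... | is-u = [ (λ Qx → x , Adj-sym xu , subst Q (sym (extend-kept x')) Qx)
                   , (λ Qv → v , uv , subst Q (sym extend-v) Qv)
                   ] (at-u (subst P extend-u Pa))
      ... | is-v = [ (λ Qu → u , Adj-sym uv , subst Q (sym extend-u) Qu)
                   , (λ Qw → w , vw , subst Q (sym extend-w) Qw)
                   ] (at-v (subst P extend-v Pa))
      ... | is-w = [ (λ Qv → v , Adj-sym vw , subst Q (sym extend-v) Qv)
                   , (λ Qy → y , wy , subst Q (sym (extend-kept y')) Qy)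
                   ] (at-w (subst P extend-w Pa))

none full : Sub12
none = false , false
full = true , true

complement : Sub12 → Sub12
complement (a , b) = not a , not b

sub12s : List Sub12
sub12s = (false , false) ∷ (false , true) ∷ (true , false) ∷ (true , true) ∷ []

sub12s-complete : ∀ s → s ∈ sub12s
sub12s-complete (false , false) = here refl
sub12s-complete (false , true)  = there (here refl)
sub12s-complete (true , false)  = there (there (here refl))
sub12s-complete (true , true)   = there (there (there (here refl)))

Empty Has₁ Has₂ : Sub12 → Set
Empty s = T (isEmpty12 s)
Has₁ s = T (proj₁ s)
Has₂ s = T (proj₂ s)

-- If x is labelled ∅ but y is not, u copies the label of y (which x relied on)
-- and w receives its complement, so that v, labelled ∅, sees both colours;
-- symmetrically if only y is labelled ∅.
rainbowPatch : Sub12 → Sub12 → Patch Sub12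
rainbowPatch X Y with isEmpty12 X | isEmpty12 Y
... | true  | false = ⟨ Y , none , complement Y ⟩
... | false | true  = ⟨ complement X , none , X ⟩
... | _     | _     = ⟨ none , full , none ⟩

RainbowPatchOK : Sub12 → Sub12 → Set
RainbowPatchOK X Y =
  Repair Empty Has₁ X Y p × Repair Empty Has₂ X Y p × cost size12 p ≡ 2
  where p = rainbowPatch X Y

rainbowPatch-ok : ∀ X Y → RainbowPatchOK X Y
rainbowPatch-ok = byExhaustion₂
  (λ X Y → let p = rainbowPatch X Y in
    repair? (T? ∘ isEmpty12) (T? ∘ proj₁) X Y p ×-dec
    repair? (T? ∘ isEmpty12) (T? ∘ proj₂) X Y p ×-dec
    cost size12 p ≟ℕ 2)
  sub12s sub12s-complete _

Zero Two : Fin 3 → Set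
Zero g = toℕ g ≡ 0
Two g = toℕ g ≡ 2

-- If x is labelled 0 and y is labelled 2, u receives 2 (it guards x and v, and
-- w is guarded by y); symmetrically with x and y exchanged.  Otherwise v
-- receives 2.
romanPatch : Fin 3 → Fin 3 → Patch (Fin 3)
romanPatch zero (suc (suc zero)) = ⟨ # 2 , # 0 , # 0 ⟩
romanPatch (suc (suc zero)) zero = ⟨ # 0 , # 0 , # 2 ⟩
romanPatch _ _                   = ⟨ # 0 , # 2 , # 0 ⟩

RomanPatchOK : Fin 3 → Fin 3 → Set
RomanPatchOK X Y = Repair Zero Two X Y (romanPatch X Y) × cost toℕ (romanPatch X Y) ≡ 2

romanPatch-ok : ∀ X Y → RomanPatchOK X Y
romanPatch-ok = byExhaustion₂
  (λ X Y → repair? (λ g → toℕ g ≟ℕ 0) (λ g → toℕ g ≟ℕ 2) X Y (romanPatch X Y) ×-dec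
           cost toℕ (romanPatch X Y) ≟ℕ 2)
  (allFin 3) ∈-allFin _

module Bounds (G : Graph) {x u v w y : V G} (path : InducedP5 G x u v w y) where
  open Reduction G path

  rainbow-bound : ∀ a b → IsRainbowDomNumber G a → IsRainbowDomNumber G' b → a ≤ b + 2
  rainbow-bound a b (_ , minimal) ((f' , f'-rainbow , f'-weight) , _) =
    ≤-trans (minimal extend extend-rainbow) (≤-reflexive weight)
    where
      open Extension f' (rainbowPatch (f' x') (f' y'))
      ok : RainbowPatchOK (f' x') (f' y')
      ok = rainbowPatch-ok (f' x') (f' y')

      extend-rainbow : Is2RDF G extend
      extend-rainbow z z-empty =
        extend-dominates (λ s e → proj₁ (f'-rainbow s e)) (proj₁ ok) z z-empty ,
        extend-dominates (λ s e → proj₂ (f'-rainbow s e)) (proj₁ (proj₂ ok)) z z-empty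

      weight : weight2R G extend ≡ b + 2
      weight = trans (extend-weight size12) (cong₂ _+_ f'-weight (proj₂ (proj₂ ok)))

  roman-bound : ∀ a b → IsRomanDomNumber G a → IsRomanDomNumber G' b → a ≤ b + 2
  roman-bound a b (_ , minimal) ((g' , g'-roman , g'-weight) , _) =
    ≤-trans (minimal extend (extend-dominates g'-roman (proj₁ ok))) (≤-reflexive weight)
    where
      open Extension g' (romanPatch (g' x') (g' y'))
      ok : RomanPatchOK (g' x') (g' y')
      ok = romanPatch-ok (g' x') (g' y')

      weight : weightR G extend ≡ b + 2
      weight = trans (extend-weight toℕ) (cong₂ _+_ g'-weight (proj₂ ok))

lemma6 : (G : Graph) (x u v w y : V G) (P : InducedP5 G x u v w y) →
    degree G u ≡ 2 → degree G v ≡ 2 → degree G w ≡ 2 →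
    let G' = Contract.G' G x u v w y (InducedP5.x≢y P) in
    (order G' ≡ order G ∸ 3)
    × (∀ a b → IsRainbowDomNumber G a → IsRainbowDomNumber G' b → a ≤ b + 2)
    × (∀ a b → IsRomanDomNumber G a → IsRomanDomNumber G' b → a ≤ b + 2)
lemma6 G x u v w y P _ _ _ =
  Reduction.order-G' G P , Bounds.rainbow-bound G P , Bounds.roman-bound G P
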